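{- Let $p \ge 5$ be prime. Then for all $i \in \mathbb{Z}_p \setminus \{0\}$ and all $j \in \mathbb{Z}_p$, $\mathrm{Cay}(D_{2p}; \{r_{i}, r_{ -i}, r_{2i}, r_{ -2i}, s_j, s_{i+j}, s_{2i+j}, s_{3i+j}\}) \cong \mathrm{Cay}(\mathbb{Z}_{2p}; \pm\{1, 2, 3, 4\})$.
   Context: $D_{2p}$ is the dihedral group of order $2p$ with elements $r_0,\dots,r_{p-1},s_0,\dots,s_{p-1}$ and multiplication $r_a r_b = r_{a+b}$, $r_a s_b = s_{a+b}$, $s_a r_b = s_{a-b}$, $s_a s_b = r_{a-b}$, subscripts taken modulo $p$. For a group $G$ and a subset $S$ not containing the identity and closed under inverses, $\mathrm{Cay}(G;S)$ has vertex set $G$ with $g$ adjacent to $g\cdot x$ for each $x\in S$. $\pm\{1,2,3,4\}=\{\pm1,\pm2,\pm3,\pm4\}$. -}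

module Defs where

open import Data.Nat using (ℕ; _+_; _*_; _∸_; NonZero)
open import Data.Nat.Properties using (m*n≢0)
open import Data.Nat.DivMod using (_mod_)
open import Data.Fin using (Fin; toℕ)
open import Data.Product using (Σ; _×_)
open import Data.List using (List; _∷_; [])
open import Data.List.Membership.Propositional using (_∈_)
open import Relation.Binary.PropositionalEquality using (_≡_)
open import Function.Bundles using (_⤖_; _⇔_; Bijection)

module ZMod (n : ℕ) .{{_ : NonZero n}} where
  infixl 6 _⊕_ _⊖_

  [_] : ℕ → Fin n
  [ k ] = k mod n

  _⊕_ : Fin n → Fin n → Fin n
  a ⊕ b = [ toℕ a + toℕ b ]

  ⊝_ : Fin n → Fin n
  ⊝ a = [ n ∸ toℕ a ]

  _⊖_ : Fin n → Fin n → Fin n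
  a ⊖ b = a ⊕ (⊝ b)

  _·_ : ℕ → Fin n → Fin n
  k · a = [ k * toℕ a ]

record Graph : Set₁ where
  field
    Vertex : Set
    Adj    : Vertex → Vertex → Set

open Graph public

Cay : (G : Set) → (G → G → G) → List G → Graph
Cay G _∙_ S = record
  { Vertex = G
  ; Adj    = λ g h → Σ G (λ x → x ∈ S × h ≡ g ∙ x)
  }

_≅_ : Graph → Graph → Set
Γ ≅ Δ = Σ (Vertex Γ ⤖ Vertex Δ) λ f →
          ∀ u v → Adj Γ u v ⇔ Adj Δ (Bijection.to f u) (Bijection.to f v)

data Dih (p : ℕ) : Set where
  r : Fin p → Dih p
  s : Fin p → Dih p

module Dihedral (p : ℕ) .{{_ : NonZero p}} where
  open ZMod p

  _∘ᴰ_ : Dih p → Dih p → Dih p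
  r a ∘ᴰ r b = r (a ⊕ b)
  r a ∘ᴰ s b = s (a ⊕ b)
  s a ∘ᴰ r b = s (a ⊖ b)
  s a ∘ᴰ s b = r (a ⊖ b)

  connD : Fin p → Fin p → List (Dih p)
  connD i j =
    r i ∷ r (⊝ i) ∷ r (2 · i) ∷ r (⊝ (2 · i)) ∷
    s j ∷ s (i ⊕ j) ∷ s ((2 · i) ⊕ j) ∷ s ((3 · i) ⊕ j) ∷ []

  CayD : Fin p → Fin p → Graph
  CayD i j = Cay (Dih p) _∘ᴰ_ (connD i j)

module Circ (p : ℕ) .{{_ : NonZero p}} where
  instance
    nz2p : NonZero (2 * p)
    nz2p = m*n≢0 2 p

  open ZMod (2 * p)

  conn± : List (Fin (2 * p))
  conn± = [ 1 ] ∷ ⊝ [ 1 ] ∷ [ 2 ] ∷ ⊝ [ 2 ] ∷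
          [ 3 ] ∷ ⊝ [ 3 ] ∷ [ 4 ] ∷ ⊝ [ 4 ] ∷ []

  CayZ : Graph
  CayZ = Cay (Fin (2 * p)) _⊕_ conn±

-- Let c be an inverse of i modulo p. The map f : D₂ₚ → ℤ₂ₚ given by
--   f(r_a) = 2·(c·a),   f(s_a) = 2·(c·(a − j) − 2) + 1
-- is a bijection: it sends rotations to even and reflections to odd residues,
-- in each case through an affine bijection of ℤₚ. It is moreover a crossed
-- homomorphism, f(u·x) = f(u) + ε(u)·f(x) with ε(r_a) = 1 and ε(s_a) = −1, so
-- the neighbours of f(u) are f(u) ± f(S). Finally f maps the connection set S
-- onto {2, −2, 4, −4, −3, −1, 1, 3} = ±{1, 2, 3, 4}, which is closed under
-- negation.

module Submission where

open import Data.Nat as ℕ using (ℕ; NonZero; _≤_)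
import Data.Nat.Properties as ℕ
import Data.Nat.Divisibility as ℕ
open import Data.Nat.Coprimality using (Coprime; coprime-Bézout; prime⇒coprime)
open import Data.Nat.GCD using (module Bézout)
open import Data.Nat.Primality using (Prime)
open import Data.Integer using (ℤ; +_; _+_; _*_; -_; _-_; ∣_∣)
open import Data.Integer.Properties
  using (pos-+; pos-*; m-n≡m⊖n; ⊖-≥; ∣m⊝n∣≤m⊔n; ∣i∣≡0⇒i≡0; i-j≡0⇒i≡j; +-injective; +-inverseʳ; +-comm;
         *-comm; *-zeroˡ; *-identityˡ; *-identityʳ; -1*i≡-i; neg-distribˡ-*; neg-involutive)
open import Data.Integer.DivMod using (_%ℕ_; _/ℕ_; n%ℕd<d; a≡a%ℕn+[a/ℕn]*n)
open import Data.Integer.Divisibility.Signed using (_∣_; divides; ∣⇒∣ᵤ; ∣m∣n⇒∣m+n; ∣m⇒∣-m; ∣n⇒∣m*n; *-monoʳ-∣)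
open import Data.Integer.Tactic.RingSolver using (solve-∀)
open import Data.Fin using (Fin; zero; suc; toℕ; fromℕ<; cast; combine; remQuot)
open import Data.Fin.Properties
  using (toℕ<n; toℕ-injective; toℕ-fromℕ<; toℕ-cast; cast-involutive; toℕ-combine; combine-remQuot; remQuot-combine)
open import Data.List using (List; _∷_; []; map)
open import Data.List.Properties using (map-id)
open import Data.List.Membership.Propositional.Properties using (∈-map⁺; ∈-map⁻)
open import Data.List.Relation.Binary.Pointwise using (Pointwise-≡⇒≡; []; _∷_)
open import Data.List.Relation.Binary.Permutation.Propositional
  using (_↭_; ↭-refl; ↭-reflexive; ↭-trans; ↭-sym; prep; swap; module PermutationReasoning)
open import Data.List.Relation.Binary.Permutation.Propositional.Properties using (map⁺; ∈-resp-↭; shift)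
open import Data.Product using (_×_; _,_; ∃-syntax)
open import Function.Bundles using (_↔_; _⤖_; Inverse; Bijection; mk↔ₛ′; mk⇔)
open import Function.Construct.Composition using (_↔-∘_)
open import Function.Properties.Inverse using (↔⇒⤖)
open import Relation.Binary using (Setoid; IsEquivalence)
open import Relation.Binary.PropositionalEquality
  using (_≡_; _≢_; refl; sym; trans; cong; subst; module ≡-Reasoning)
open import Relation.Nullary using (contradiction)
open import Defs

infix 4 _≡_mod_
record _≡_mod_ (a b : ℤ) (n : ℕ) : Set where
  constructor by-divisibility
  field divisibility : + n ∣ a - b

private
  mod-by : ∀ {n x a b} → + n ∣ x → x ≡ a - b → a ≡ b mod n
  mod-by n∣x refl = by-divisibility n∣x

module _ {n : ℕ} where

  mod-reflexive : ∀ {a b} → a ≡ b → a ≡ b mod n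
  mod-reflexive {a} refl = by-divisibility (divides (+ 0) (trans (+-inverseʳ a) (sym (*-zeroˡ (+ n)))))

  mod-sym : ∀ {a b} → a ≡ b mod n → b ≡ a mod n
  mod-sym {a} {b} (by-divisibility n∣a-b) = mod-by (∣m⇒∣-m n∣a-b) (ring a b)
    where
    ring : ∀ a b → - (a - b) ≡ b - a
    ring = solve-∀

  mod-trans : ∀ {a b c} → a ≡ b mod n → b ≡ c mod n → a ≡ c mod n
  mod-trans {a} {b} {c} (by-divisibility n∣a-b) (by-divisibility n∣b-c) = mod-by (∣m∣n⇒∣m+n n∣a-b n∣b-c) (ring a b c)
    where
    ring : ∀ a b c → (a - b) + (b - c) ≡ a - c
    ring = solve-∀

  mod-+ : ∀ {a b c d} → a ≡ b mod n → c ≡ d mod n → a + c ≡ b + d mod n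
  mod-+ {a} {b} {c} {d} (by-divisibility n∣a-b) (by-divisibility n∣c-d) = mod-by (∣m∣n⇒∣m+n n∣a-b n∣c-d) (ring a b c d)
    where
    ring : ∀ a b c d → (a - b) + (c - d) ≡ (a + c) - (b + d)
    ring = solve-∀

  mod-+ˡ : ∀ a {b c} → b ≡ c mod n → a + b ≡ a + c mod n
  mod-+ˡ a = mod-+ (mod-reflexive {a} refl)

  mod-+ʳ : ∀ c {a b} → a ≡ b mod n → a + c ≡ b + c mod n
  mod-+ʳ c a≡b = mod-+ a≡b (mod-reflexive {c} refl)

  mod-neg : ∀ {a b} → a ≡ b mod n → - a ≡ - b mod n
  mod-neg {a} {b} (by-divisibility n∣a-b) = mod-by (∣m⇒∣-m n∣a-b) (ring a b)
    where
    ring : ∀ a b → - (a - b) ≡ - a - - b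
    ring = solve-∀

  mod-*ˡ : ∀ k {a b} → a ≡ b mod n → k * a ≡ k * b mod n
  mod-*ˡ k {a} {b} (by-divisibility n∣a-b) = mod-by (∣n⇒∣m*n k n∣a-b) (ring k a b)
    where
    ring : ∀ k a b → k * (a - b) ≡ k * a - k * b
    ring = solve-∀

  mod-*ʳ : ∀ k {a b} → a ≡ b mod n → a * k ≡ b * k mod n
  mod-*ʳ k {a} {b} (by-divisibility n∣a-b) = mod-by (∣n⇒∣m*n k n∣a-b) (ring k a b)
    where
    ring : ∀ k a b → k * (a - b) ≡ a * k - b * k
    ring = solve-∀

  mod-+-multiple : ∀ a k → a + k * + n ≡ a mod n
  mod-+-multiple a k = by-divisibility (divides k (cancel a k (+ n)))
    where
    cancel : ∀ a k m → a + k * m - a ≡ k * m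
    cancel = solve-∀

  mod-isEquivalence : IsEquivalence (_≡_mod n)
  mod-isEquivalence = record { refl = mod-reflexive refl ; sym = mod-sym ; trans = mod-trans }

mod-setoid : ℕ → Setoid _ _
mod-setoid n = record { isEquivalence = mod-isEquivalence {n} }

mod-scale : ∀ k {n a b} → a ≡ b mod n → + k * a ≡ + k * b mod k ℕ.* n
mod-scale k {n} {a} {b} (by-divisibility n∣a-b) =
  mod-by (subst (_∣ + k * (a - b)) (sym (pos-* k n)) (*-monoʳ-∣ (+ k) n∣a-b)) (distrib (+ k) a b)
  where
  distrib : ∀ k a b → k * (a - b) ≡ k * a - k * b
  distrib = solve-∀

m∣n<m⇒n≡0 : ∀ {m n} → m ℕ.∣ n → n ℕ.< m → n ≡ 0
m∣n<m⇒n≡0 {n = ℕ.zero}  _   _   = refl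
m∣n<m⇒n≡0 {n = ℕ.suc _} m∣n n<m = contradiction m∣n (ℕ.>⇒∤ n<m)

module Residues (n : ℕ) .{{_ : NonZero n}} where
  open ZMod n
  open import Relation.Binary.Reasoning.Setoid (mod-setoid n)

  ι : Fin n → ℤ
  ι a = + toℕ a

  ⟦_⟧ : ℤ → Fin n
  ⟦ z ⟧ = fromℕ< (n%ℕd<d z n)

  ι-⟦⟧ : ∀ z → ι ⟦ z ⟧ ≡ z mod n
  ι-⟦⟧ z = begin
    ι ⟦ z ⟧                          ≡⟨ cong +_ (toℕ-fromℕ< (n%ℕd<d z n)) ⟩
    + (z %ℕ n)                       ≈⟨ mod-+-multiple (+ (z %ℕ n)) (z /ℕ n) ⟨
    + (z %ℕ n) + (z /ℕ n) * + n      ≡⟨ a≡a%ℕn+[a/ℕn]*n z n ⟨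
    z                                ∎

  ι-injective : ∀ {a b} → ι a ≡ ι b mod n → a ≡ b
  ι-injective {a} {b} (by-divisibility n∣a-b) =
    toℕ-injective (+-injective (i-j≡0⇒i≡j (ι a) (ι b) (∣i∣≡0⇒i≡0 ∣a-b∣≡0)))
    where
    ∣a-b∣<n : ∣ ι a - ι b ∣ ℕ.< n
    ∣a-b∣<n = subst (ℕ._< n) (cong ∣_∣ (sym (m-n≡m⊖n (toℕ a) (toℕ b))))
                    (ℕ.≤-<-trans (∣m⊝n∣≤m⊔n (toℕ a) (toℕ b)) (ℕ.⊔-pres-<m (toℕ<n a) (toℕ<n b)))
    ∣a-b∣≡0 : ∣ ι a - ι b ∣ ≡ 0
    ∣a-b∣≡0 = m∣n<m⇒n≡0 (∣⇒∣ᵤ n∣a-b) ∣a-b∣<n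

  ι-[] : ∀ k → ι [ k ] ≡ + k mod n
  ι-[] k = ι-⟦⟧ (+ k)

  ι-⊕ : ∀ a b → ι (a ⊕ b) ≡ ι a + ι b mod n
  ι-⊕ a b = begin
    ι (a ⊕ b)  ≈⟨ ι-[] (toℕ a ℕ.+ toℕ b) ⟩
    + (toℕ a ℕ.+ toℕ b) ≡⟨ pos-+ (toℕ a) (toℕ b) ⟩
    ι a + ι b ∎

  ι-⊝ : ∀ a → ι (⊝ a) ≡ - ι a mod n
  ι-⊝ a = begin
    ι (⊝ a) ≈⟨ ι-[] (n ℕ.∸ toℕ a) ⟩
    + (n ℕ.∸ toℕ a) ≡⟨ trans (m-n≡m⊖n n (toℕ a)) (⊖-≥ (ℕ.<⇒≤ (toℕ<n a))) ⟨
    + n - ι a ≡⟨ +-comm (+ n) (- ι a) ⟩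
    - ι a + + n ≡⟨ cong (λ m → - ι a + m) (*-identityˡ (+ n)) ⟨
    - ι a + + 1 * + n ≈⟨ mod-+-multiple (- ι a) (+ 1) ⟩
    - ι a ∎

  ι-· : ∀ k a → ι (k · a) ≡ + k * ι a mod n
  ι-· k a = begin
    ι (k · a) ≈⟨ ι-[] (k ℕ.* toℕ a) ⟩
    + (k ℕ.* toℕ a) ≡⟨ pos-* k (toℕ a) ⟩
    + k * ι a ∎

  ι-⊝[] : ∀ k → ι (⊝ [ k ]) ≡ - + k mod n
  ι-⊝[] k = mod-trans (ι-⊝ [ k ]) (mod-neg (ι-[] k))

  ι-⊖ : ∀ a b → ι (a ⊖ b) ≡ ι a - ι b mod n
  ι-⊖ a b = mod-trans (ι-⊕ a (⊝ b)) (mod-+ˡ (ι a) (ι-⊝ b))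

  ⊝-involutive : ∀ a → ⊝ ⊝ a ≡ a
  ⊝-involutive a = ι-injective (begin
    ι (⊝ ⊝ a) ≈⟨ ι-⊝ (⊝ a) ⟩
    - ι (⊝ a) ≈⟨ mod-neg (ι-⊝ a) ⟩
    - - ι a   ≡⟨ neg-involutive (ι a) ⟩
    ι a       ∎)

  ±_ : List (Fin n) → List (Fin n)
  ± []       = []
  ± (x ∷ xs) = x ∷ ⊝ x ∷ ± xs

  map-⊝-± : ∀ xs → map ⊝_ (± xs) ↭ ± xs
  map-⊝-± []       = ↭-refl
  map-⊝-± (x ∷ xs) = ↭-trans (↭-reflexive (cong (λ y → ⊝ x ∷ y ∷ map ⊝_ (± xs)) (⊝-involutive x)))
                             (swap (⊝ x) x (map-⊝-± xs))

  affine-↔ : ∀ c c⁻¹ d → c⁻¹ * c ≡ + 1 mod n → Fin n ↔ Fin n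
  affine-↔ c c⁻¹ d c⁻¹c≡1 = mk↔ₛ′ (λ x → ⟦ c * ι x + d ⟧) (λ y → ⟦ c⁻¹ * (ι y - d) ⟧) to∘from from∘to
    where
    unit-rearrange₁ : ∀ c c⁻¹ y d → c * (c⁻¹ * (y - d)) + d ≡ (c⁻¹ * c) * (y - d) + d
    unit-rearrange₁ = solve-∀
    unit-rearrange₂ : ∀ c c⁻¹ x d → c⁻¹ * ((c * x + d) - d) ≡ (c⁻¹ * c) * x
    unit-rearrange₂ = solve-∀
    cancel : ∀ y d → + 1 * (y - d) + d ≡ y
    cancel = solve-∀

    to∘from : ∀ y → ⟦ c * ι ⟦ c⁻¹ * (ι y - d) ⟧ + d ⟧ ≡ y
    to∘from y = ι-injective (begin
      ι ⟦ c * ι ⟦ c⁻¹ * (ι y - d) ⟧ + d ⟧ ≈⟨ ι-⟦⟧ _ ⟩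
      c * ι ⟦ c⁻¹ * (ι y - d) ⟧ + d       ≈⟨ mod-+ʳ d (mod-*ˡ c (ι-⟦⟧ (c⁻¹ * (ι y - d)))) ⟩
      c * (c⁻¹ * (ι y - d)) + d           ≡⟨ unit-rearrange₁ c c⁻¹ (ι y) d ⟩
      (c⁻¹ * c) * (ι y - d) + d           ≈⟨ mod-+ʳ d (mod-*ʳ (ι y - d) c⁻¹c≡1) ⟩
      + 1 * (ι y - d) + d                 ≡⟨ cancel (ι y) d ⟩
      ι y                                 ∎)

    from∘to : ∀ x → ⟦ c⁻¹ * (ι ⟦ c * ι x + d ⟧ - d) ⟧ ≡ x
    from∘to x = ι-injective (begin
      ι ⟦ c⁻¹ * (ι ⟦ c * ι x + d ⟧ - d) ⟧ ≈⟨ ι-⟦⟧ _ ⟩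
      c⁻¹ * (ι ⟦ c * ι x + d ⟧ - d)       ≈⟨ mod-*ˡ c⁻¹ (mod-+ʳ (- d) (ι-⟦⟧ (c * ι x + d))) ⟩
      c⁻¹ * ((c * ι x + d) - d)           ≡⟨ unit-rearrange₂ c c⁻¹ (ι x) d ⟩
      (c⁻¹ * c) * ι x                     ≈⟨ mod-*ʳ (ι x) c⁻¹c≡1 ⟩
      + 1 * ι x                           ≡⟨ *-identityˡ (ι x) ⟩
      ι x                                 ∎)

interleave : ∀ {n} → (Fin n × Fin 2) ↔ Fin (2 ℕ.* n)
interleave {n} = mk↔ₛ′ (λ (m , b) → cast n*2≡2*n (combine m b)) (λ z → remQuot 2 (cast (sym n*2≡2*n) z))
  (λ z → trans (cong (cast n*2≡2*n) (combine-remQuot {n} 2 (cast (sym n*2≡2*n) z))) (cast-involutive n*2≡2*n (sym n*2≡2*n) z))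
  (λ (m , b) → trans (cong (remQuot 2) (cast-involutive (sym n*2≡2*n) n*2≡2*n (combine m b))) (remQuot-combine m b))
  where
  n*2≡2*n : n ℕ.* 2 ≡ 2 ℕ.* n
  n*2≡2*n = ℕ.*-comm n 2

ι-interleave : ∀ {n} (m : Fin n) (b : Fin 2) → + toℕ (Inverse.to interleave (m , b)) ≡ + 2 * + toℕ m + + toℕ b
ι-interleave {n} m b = begin
  + toℕ (cast (ℕ.*-comm n 2) (combine m b))  ≡⟨ cong +_ (toℕ-cast (ℕ.*-comm n 2) (combine m b)) ⟩
  + toℕ (combine m b)                         ≡⟨ cong +_ (toℕ-combine m b) ⟩
  + (2 ℕ.* toℕ m ℕ.+ toℕ b)                   ≡⟨ pos-+ (2 ℕ.* toℕ m) (toℕ b) ⟩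
  + (2 ℕ.* toℕ m) + + toℕ b                   ≡⟨ cong (λ t → t + + toℕ b) (pos-* 2 (toℕ m)) ⟩
  + 2 * + toℕ m + + toℕ b                     ∎
  where open ≡-Reasoning

Dih↔ : ∀ {p} → Fin p ↔ Fin p → Fin p ↔ Fin p → Dih p ↔ (Fin p × Fin 2)
Dih↔ {p} α β = mk↔ₛ′ to from to∘from from∘to
  where
  module α = Inverse α
  module β = Inverse β
  to : Dih p → Fin p × Fin 2
  to (r a) = α.to a , zero
  to (s a) = β.to a , suc zero
  from : Fin p × Fin 2 → Dih p
  from (m , zero)     = r (α.from m)
  from (m , suc zero) = s (β.from m)
  to∘from : ∀ mb → to (from mb) ≡ mb
  to∘from (m , zero)     = cong (_, zero) (α.strictlyInverseˡ m)
  to∘from (m , suc zero) = cong (_, suc zero) (β.strictlyInverseˡ m)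
  from∘to : ∀ u → from (to u) ≡ u
  from∘to (r a) = cong r (α.strictlyInverseʳ a)
  from∘to (s a) = cong s (β.strictlyInverseʳ a)

module _ {G H : Set} (_∙_ : G → G → G) (_+_ : H → H → H) {S : List G} {T : List H}
         (f : G ⤖ H) (σ : G → H → H) where
  private
    F : G → H
    F = Bijection.to f

  crossedHom⇒Cay-≅ : (∀ u x → F (u ∙ x) ≡ F u + σ u (F x)) →
                     map F S ↭ T → (∀ u → map (σ u) T ↭ T) →
                     Cay G _∙_ S ≅ Cay H _+_ T
  crossedHom⇒Cay-≅ crossed f[S]↭T σ[T]↭T = f , λ u v → mk⇔ (forth u v) (back u v)
    where
    σf[S]↭T : ∀ u → map (σ u) (map F S) ↭ T
    σf[S]↭T u = ↭-trans (map⁺ (σ u) f[S]↭T) (σ[T]↭T u)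

    forth : ∀ u v → Adj (Cay G _∙_ S) u v → Adj (Cay H _+_ T) (F u) (F v)
    forth u _ (x , x∈S , refl) =
      σ u (F x) , ∈-resp-↭ (σf[S]↭T u) (∈-map⁺ (σ u) (∈-map⁺ F x∈S)) , crossed u x

    back : ∀ u v → Adj (Cay H _+_ T) (F u) (F v) → Adj (Cay G _∙_ S) u v
    back u v (y , y∈T , Fv≡Fu+y) with ∈-map⁻ (σ u) (∈-resp-↭ (↭-sym (σf[S]↭T u)) y∈T)
    ... | y′ , y′∈f[S] , refl with ∈-map⁻ F y′∈f[S]
    ... | x , x∈S , refl = x , x∈S , Bijection.injective f (trans Fv≡Fu+y (sym (crossed u x)))

private
  pos-1+*≡* : ∀ a b c d → 1 ℕ.+ a ℕ.* b ≡ c ℕ.* d → + 1 + + a * + b ≡ + c * + d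
  pos-1+*≡* a b c d e = begin
    + 1 + + a * + b    ≡⟨ cong (λ m → + 1 + m) (pos-* a b) ⟨
    + (1 ℕ.+ a ℕ.* b)  ≡⟨ cong +_ e ⟩
    + (c ℕ.* d)        ≡⟨ pos-* c d ⟩
    + c * + d          ∎
    where open ≡-Reasoning

coprime⇒invertible : ∀ {n k} → Coprime n k → ∃[ c ] c * + k ≡ + 1 mod n
coprime⇒invertible {n} {k} n⊥k with coprime-Bézout n⊥k
... | Bézout.-+ x y 1+xn≡yk =
  + y , mod-trans (mod-reflexive (sym (pos-1+*≡* x n y k 1+xn≡yk))) (mod-+-multiple (+ 1) (+ x))
... | Bézout.+- x y 1+yk≡xn = - + y , (begin
  - + y * + k                ≡⟨ rearrange (+ y) (+ k) ⟩
  + 1 + - (+ 1 + + y * + k)  ≡⟨ cong (λ t → + 1 + - t) (pos-1+*≡* y k x n 1+yk≡xn) ⟩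
  + 1 + - (+ x * + n)        ≡⟨ cong (λ t → + 1 + t) (neg-distribˡ-* (+ x) (+ n)) ⟩
  + 1 + - + x * + n          ≈⟨ mod-+-multiple (+ 1) (- + x) ⟩
  + 1                        ∎)
  where
  open import Relation.Binary.Reasoning.Setoid (mod-setoid n)
  rearrange : ∀ y k → - y * k ≡ + 1 + - (+ 1 + y * k)
  rearrange = solve-∀

module CayleyIsomorphism (p : ℕ) .{{_ : NonZero p}} (i j : Fin p) (c : ℤ) (ci≡1 : c * + toℕ i ≡ + 1 mod p) where
  open Dihedral p using (_∘ᴰ_; connD; CayD)
  open Circ p using (conn±; CayZ; nz2p)
  module ℤₚ = ZMod p
  open Residues p using (ι; ⟦_⟧; ι-⟦⟧; ι-⊕; ι-⊖; ι-⊝; ι-·; affine-↔)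
  open Residues (2 ℕ.* p) using (±_; map-⊝-±; ι-[]; ι-⊝[])
    renaming (ι to ι₂; ι-injective to ι₂-injective; ι-⊕ to ι₂-⊕; ι-⊝ to ι₂-⊝)
  open ZMod (2 ℕ.* p) using ([_]; ⊝_; _⊕_)

  I J d : ℤ
  I = ι i
  J = ι j
  d = - (c * J) - + 2   -- so that f (s j) = −3

  Ic≡1 : I * c ≡ + 1 mod p
  Ic≡1 = mod-trans (mod-reflexive (*-comm I c)) ci≡1

  φ : Dih p ↔ Fin (2 ℕ.* p)
  φ = interleave ↔-∘ Dih↔ (affine-↔ c I (+ 0) Ic≡1) (affine-↔ c I d Ic≡1)

  f : Dih p → Fin (2 ℕ.* p)
  f = Inverse.to φ

  -- f u is the residue of 2 · level u + parity u; the offset + 0 keeps level (r a)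
  -- literally the affine map used in φ.
  level parity : Dih p → ℤ
  level (r a) = c * ι a + + 0
  level (s a) = c * ι a + d
  parity (r _) = + 0
  parity (s _) = + 1

  ι-f : ∀ u → ι₂ (f u) ≡ + 2 * level u + parity u mod 2 ℕ.* p
  ι-f (r a) = mod-trans (mod-reflexive (ι-interleave ⟦ level (r a) ⟧ zero))
                        (mod-+ʳ (+ 0) (mod-scale 2 (ι-⟦⟧ (level (r a)))))
  ι-f (s a) = mod-trans (mod-reflexive (ι-interleave ⟦ level (s a) ⟧ (suc zero)))
                        (mod-+ʳ (+ 1) (mod-scale 2 (ι-⟦⟧ (level (s a)))))

  ε : Dih p → ℤ
  ε (r _) = + 1
  ε (s _) = - + 1

  σ : Dih p → Fin (2 ℕ.* p) → Fin (2 ℕ.* p)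
  σ (r _) y = y
  σ (s _) y = ⊝ y

  ι-σ : ∀ u y → ι₂ (σ u y) ≡ ε u * ι₂ y mod 2 ℕ.* p
  ι-σ (r _) y = mod-reflexive (sym (*-identityˡ (ι₂ y)))
  ι-σ (s _) y = mod-trans (ι₂-⊝ y) (mod-reflexive (sym (-1*i≡-i (ι₂ y))))

  parity-crossed : ∀ u x → parity (u ∘ᴰ x) ≡ parity u + ε u * parity x
  parity-crossed (r _) (r _) = refl
  parity-crossed (r _) (s _) = refl
  parity-crossed (s _) (r _) = refl
  parity-crossed (s _) (s _) = refl

  level-crossed : ∀ u x → level (u ∘ᴰ x) ≡ level u + ε u * level x mod p
  level-crossed (r a) (r b) = mod-trans (mod-+ʳ (+ 0) (mod-*ˡ c (ι-⊕ a b))) (mod-reflexive (ring c (ι a) (ι b)))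
    where
    ring : ∀ c A B → c * (A + B) + + 0 ≡ (c * A + + 0) + + 1 * (c * B + + 0)
    ring = solve-∀
  level-crossed (r a) (s b) = mod-trans (mod-+ʳ d (mod-*ˡ c (ι-⊕ a b))) (mod-reflexive (ring c (ι a) (ι b) d))
    where
    ring : ∀ c A B d → c * (A + B) + d ≡ (c * A + + 0) + + 1 * (c * B + d)
    ring = solve-∀
  level-crossed (s a) (r b) = mod-trans (mod-+ʳ d (mod-*ˡ c (ι-⊖ a b))) (mod-reflexive (ring c (ι a) (ι b) d))
    where
    ring : ∀ c A B d → c * (A - B) + d ≡ (c * A + d) + - + 1 * (c * B + + 0)
    ring = solve-∀
  level-crossed (s a) (s b) = mod-trans (mod-+ʳ (+ 0) (mod-*ˡ c (ι-⊖ a b))) (mod-reflexive (ring c (ι a) (ι b) d))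
    where
    ring : ∀ c A B d → c * (A - B) + + 0 ≡ (c * A + d) + - + 1 * (c * B + d)
    ring = solve-∀

  f-crossed : ∀ u x → f (u ∘ᴰ x) ≡ f u ⊕ σ u (f x)
  f-crossed u x = ι₂-injective (begin
    ι₂ (f (u ∘ᴰ x))                                                ≈⟨ ι-f (u ∘ᴰ x) ⟩
    + 2 * level (u ∘ᴰ x) + parity (u ∘ᴰ x)                         ≈⟨ mod-+ (mod-scale 2 (level-crossed u x)) (mod-reflexive (parity-crossed u x)) ⟩
    + 2 * (level u + ε u * level x) + (parity u + ε u * parity x)  ≡⟨ regroup (level u) (ε u) (level x) (parity u) (parity x) ⟩
    (+ 2 * level u + parity u) + ε u * (+ 2 * level x + parity x)  ≈⟨ mod-+ (ι-f u) (mod-*ˡ (ε u) (ι-f x)) ⟨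
    ι₂ (f u) + ε u * ι₂ (f x)                                      ≈⟨ mod-+ˡ (ι₂ (f u)) (ι-σ u (f x)) ⟨
    ι₂ (f u) + ι₂ (σ u (f x))                                      ≈⟨ ι₂-⊕ (f u) (σ u (f x)) ⟨
    ι₂ (f u ⊕ σ u (f x))                                           ∎)
    where
    open import Relation.Binary.Reasoning.Setoid (mod-setoid (2 ℕ.* p))
    regroup : ∀ L e L′ π π′ → + 2 * (L + e * L′) + (π + e * π′) ≡ (+ 2 * L + π) + e * (+ 2 * L′ + π′)
    regroup = solve-∀

  level-r : ∀ a m → ι a ≡ m * I mod p → level (r a) ≡ m mod p
  level-r a m a≡mI = begin
    c * ι a + + 0      ≈⟨ mod-+ʳ (+ 0) (mod-*ˡ c a≡mI) ⟩
    c * (m * I) + + 0  ≡⟨ rearrange c m I ⟩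
    m * (c * I)        ≈⟨ mod-*ˡ m ci≡1 ⟩
    m * + 1            ≡⟨ *-identityʳ m ⟩
    m                  ∎
    where
    open import Relation.Binary.Reasoning.Setoid (mod-setoid p)
    rearrange : ∀ c m I → c * (m * I) + + 0 ≡ m * (c * I)
    rearrange = solve-∀

  level-s : ∀ a m → ι a ≡ m * I + J mod p → level (s a) ≡ m - + 2 mod p
  level-s a m a≡mI+J = begin
    c * ι a + d              ≈⟨ mod-+ʳ d (mod-*ˡ c a≡mI+J) ⟩
    c * (m * I + J) + d      ≡⟨ rearrange c m I J ⟩
    m * (c * I) - + 2        ≈⟨ mod-+ʳ (- + 2) (mod-*ˡ m ci≡1) ⟩
    m * + 1 - + 2            ≡⟨ cong (_- + 2) (*-identityʳ m) ⟩
    m - + 2                  ∎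
    where
    open import Relation.Binary.Reasoning.Setoid (mod-setoid p)
    rearrange : ∀ c m I J → c * (m * I + J) + (- (c * J) - + 2) ≡ m * (c * I) - + 2
    rearrange = solve-∀

  f-value : ∀ u {m y} → level u ≡ m mod p → ι₂ y ≡ + 2 * m + parity u mod 2 ℕ.* p → f u ≡ y
  f-value u {m} {y} level≡m y≡2m+parity = ι₂-injective (begin
    ι₂ (f u)                  ≈⟨ ι-f u ⟩
    + 2 * level u + parity u  ≈⟨ mod-+ʳ (parity u) (mod-scale 2 level≡m) ⟩
    + 2 * m + parity u        ≈⟨ y≡2m+parity ⟨
    ι₂ y                      ∎)
    where open import Relation.Binary.Reasoning.Setoid (mod-setoid (2 ℕ.* p))

  f[connD] : map f (connD i j) ≡ [ 2 ] ∷ ⊝ [ 2 ] ∷ [ 4 ] ∷ ⊝ [ 4 ] ∷ ⊝ [ 3 ] ∷ ⊝ [ 1 ] ∷ [ 1 ] ∷ [ 3 ] ∷ []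
  f[connD] = Pointwise-≡⇒≡
    ( f-value (r i) (level-r i (+ 1) (mod-reflexive (sym (*-identityˡ I)))) (ι-[] 2)
    ∷ f-value (r (ℤₚ.⊝ i)) (level-r (ℤₚ.⊝ i) (- + 1) (mod-trans (ι-⊝ i) (mod-reflexive (sym (-1*i≡-i I))))) (ι-⊝[] 2)
    ∷ f-value (r (2 ℤₚ.· i)) (level-r (2 ℤₚ.· i) (+ 2) (ι-· 2 i)) (ι-[] 4)
    ∷ f-value (r (ℤₚ.⊝ (2 ℤₚ.· i))) (level-r (ℤₚ.⊝ (2 ℤₚ.· i)) (- + 2)
        (mod-trans (ι-⊝ (2 ℤₚ.· i)) (mod-trans (mod-neg (ι-· 2 i)) (mod-reflexive (neg-distribˡ-* (+ 2) I))))) (ι-⊝[] 4)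
    ∷ f-value (s j) (level-s j (+ 0) (mod-reflexive refl)) (ι-⊝[] 3)
    ∷ f-value (s (i ℤₚ.⊕ j)) (level-s (i ℤₚ.⊕ j) (+ 1)
        (mod-trans (ι-⊕ i j) (mod-+ʳ J (mod-reflexive (sym (*-identityˡ I)))))) (ι-⊝[] 1)
    ∷ f-value (s ((2 ℤₚ.· i) ℤₚ.⊕ j)) (level-s ((2 ℤₚ.· i) ℤₚ.⊕ j) (+ 2)
        (mod-trans (ι-⊕ (2 ℤₚ.· i) j) (mod-+ʳ J (ι-· 2 i)))) (ι-[] 1)
    ∷ f-value (s ((3 ℤₚ.· i) ℤₚ.⊕ j)) (level-s ((3 ℤₚ.· i) ℤₚ.⊕ j) (+ 3)
        (mod-trans (ι-⊕ (3 ℤₚ.· i) j) (mod-+ʳ J (ι-· 3 i)))) (ι-[] 3)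
    ∷ [])

  f[connD]↭conn± : map f (connD i j) ↭ conn±
  f[connD]↭conn± = begin
    map f (connD i j)                                                           ≡⟨ f[connD] ⟩
    [ 2 ] ∷ ⊝ [ 2 ] ∷ [ 4 ] ∷ ⊝ [ 4 ] ∷ ⊝ [ 3 ] ∷ ⊝ [ 1 ] ∷ [ 1 ] ∷ [ 3 ] ∷ []
      ↭⟨ shift [ 1 ] ([ 2 ] ∷ ⊝ [ 2 ] ∷ [ 4 ] ∷ ⊝ [ 4 ] ∷ ⊝ [ 3 ] ∷ ⊝ [ 1 ] ∷ []) _ ⟩
    [ 1 ] ∷ [ 2 ] ∷ ⊝ [ 2 ] ∷ [ 4 ] ∷ ⊝ [ 4 ] ∷ ⊝ [ 3 ] ∷ ⊝ [ 1 ] ∷ [ 3 ] ∷ []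
      ↭⟨ prep _ (shift (⊝ [ 1 ]) ([ 2 ] ∷ ⊝ [ 2 ] ∷ [ 4 ] ∷ ⊝ [ 4 ] ∷ ⊝ [ 3 ] ∷ []) _) ⟩
    [ 1 ] ∷ ⊝ [ 1 ] ∷ [ 2 ] ∷ ⊝ [ 2 ] ∷ [ 4 ] ∷ ⊝ [ 4 ] ∷ ⊝ [ 3 ] ∷ [ 3 ] ∷ []
      ↭⟨ prep _ (prep _ (prep _ (prep _ (shift [ 3 ] ([ 4 ] ∷ ⊝ [ 4 ] ∷ ⊝ [ 3 ] ∷ []) [])))) ⟩
    [ 1 ] ∷ ⊝ [ 1 ] ∷ [ 2 ] ∷ ⊝ [ 2 ] ∷ [ 3 ] ∷ [ 4 ] ∷ ⊝ [ 4 ] ∷ ⊝ [ 3 ] ∷ []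
      ↭⟨ prep _ (prep _ (prep _ (prep _ (prep _ (shift (⊝ [ 3 ]) ([ 4 ] ∷ ⊝ [ 4 ] ∷ []) []))))) ⟩
    conn±                                                                       ∎
    where open PermutationReasoning

  σ[conn±]↭conn± : ∀ u → map (σ u) conn± ↭ conn±
  σ[conn±]↭conn± (r _) = ↭-reflexive (map-id conn±)
  σ[conn±]↭conn± (s _) = map-⊝-± ([ 1 ] ∷ [ 2 ] ∷ [ 3 ] ∷ [ 4 ] ∷ [])

  CayD≅CayZ : CayD i j ≅ CayZ
  CayD≅CayZ = crossedHom⇒Cay-≅ _∘ᴰ_ _⊕_ (↔⇒⤖ φ) σ f-crossed f[connD]↭conn± σ[conn±]↭conn±

lemma8 : (p : ℕ) .{{_ : NonZero p}} → Prime p → 5 ≤ p →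
           (i : Fin p) → toℕ i ≢ 0 → (j : Fin p) →
           Dihedral.CayD p i j ≅ Circ.CayZ p
lemma8 p p-prime _ i i≢0 j =
  let c , ci≡1 = coprime⇒invertible (prime⇒coprime p-prime {{ℕ.≢-nonZero i≢0}} (toℕ<n i))
  in CayleyIsomorphism.CayD≅CayZ p i j c ci≡1
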